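{- Let $p_3$ be a positive integer with $\gcd(6,p_3)=1$, let $0<\ell_3<p_3$ be an integer, and let $\chi=\chi_{(2,3,p_3)}^{(1,1,\ell_3)}$. Let $M,N$ be coprime positive integers and $q=e^{2\pi iM/N}$. Then $$\sum_{n=0}^{6p_3N}\chi(n)q^{\frac{n^2}{24p_3}}=4\sum_{n=0}^{2p_3N}\chi(n)q^{\frac{n^2}{24p_3}}.$$
   Context: For pairwise coprime positive integers $\bm p=(p_1,p_2,p_3)$ with $P=p_1p_2p_3$ and $\bm\ell=(\ell_1,\ell_2,\ell_3)$ with $0<\ell_j<p_j$, $\chi_{\bm p}^{\bm\ell}(n)=-\epsilon_1\epsilon_2\epsilon_3$ if $n\equiv P\bigl(1+\sum_{j=1}^3\epsilon_j\ell_j/p_j\bigr)\pmod{2P}$ for some $(\epsilon_1,\epsilon_2,\epsilon_3)\in\{\pm1\}^3$, and $0$ otherwise. Here $P=6p_3$. Fractional powers: $q^x:=e^{2\pi iMx/N}$ for real $x$. -}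

module Defs where

open import Level using (Level)
open import Data.Nat as ℕ using (ℕ; zero; suc)
open import Data.Integer as ℤ using (ℤ; +_; -[1+_])
open import Data.Integer.Divisibility.Signed using (_∣?_)
open import Data.List using (List; []; _∷_)
open import Data.Product using (_×_; _,_)
open import Relation.Nullary using (yes; no; ¬_)
open import Data.Sum using (_⊎_)
open import Relation.Binary.PropositionalEquality using (_≡_)
open import Algebra.Bundles using (CommutativeRing)

signs : List (ℤ × ℤ × ℤ)
signs = s (+ 1) (+ 1) (+ 1) ∷ s (+ 1) (+ 1) (ℤ.- + 1) ∷ s (+ 1) (ℤ.- + 1) (+ 1) ∷ s (+ 1) (ℤ.- + 1) (ℤ.- + 1)
      ∷ s (ℤ.- + 1) (+ 1) (+ 1) ∷ s (ℤ.- + 1) (+ 1) (ℤ.- + 1) ∷ s (ℤ.- + 1) (ℤ.- + 1) (+ 1) ∷ s (ℤ.- + 1) (ℤ.- + 1) (ℤ.- + 1) ∷ []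
  where
  s : ℤ → ℤ → ℤ → ℤ × ℤ × ℤ
  s a b c = a , b , c

-- χ_p^ℓ(n), p = (p₁,p₂,p₃), ℓ = (ℓ₁,ℓ₂,ℓ₃), P = p₁p₂p₃.
-- n ≡ P(1 + Σ εⱼ ℓⱼ/pⱼ) (mod 2P), where P ℓⱼ/pⱼ = ℓⱼ · (P/pⱼ) is the integer
-- ℓ₁p₂p₃, ℓ₂p₁p₃, ℓ₃p₁p₂ respectively.
chi : (p₁ p₂ p₃ ℓ₁ ℓ₂ ℓ₃ : ℕ) → ℤ → ℤ
chi p₁ p₂ p₃ ℓ₁ ℓ₂ ℓ₃ n = go signs
  where
  P : ℕ
  P = p₁ ℕ.* p₂ ℕ.* p₃
  go : List (ℤ × ℤ × ℤ) → ℤ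
  go [] = + 0
  go ((e₁ , e₂ , e₃) ∷ rest)
    with (+ (2 ℕ.* P)) ∣? (n ℤ.- (+ P ℤ.+ e₁ ℤ.* + (ℓ₁ ℕ.* p₂ ℕ.* p₃)
                                    ℤ.+ e₂ ℤ.* + (ℓ₂ ℕ.* p₁ ℕ.* p₃)
                                    ℤ.+ e₃ ℤ.* + (ℓ₃ ℕ.* p₁ ℕ.* p₂)))
  ... | yes _ = ℤ.- (e₁ ℤ.* e₂ ℤ.* e₃)
  ... | no _  = go rest

module _ {c ℓ : Level} (R : CommutativeRing c ℓ) where
  open CommutativeRing R

  natR : ℕ → Carrier
  natR zero = 0#
  natR (suc n) = 1# + natR n

  intR : ℤ → Carrier
  intR (+ n) = natR n
  intR -[1+ n ] = - natR (suc n)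

  pow : Carrier → ℕ → Carrier
  pow x zero = 1#
  pow x (suc n) = x * pow x n

  -- Σ_{n=0}^{m} f n  (inclusive upper limit)
  sumTo : (ℕ → Carrier) → ℕ → Carrier
  sumTo f zero = f 0
  sumTo f (suc m) = sumTo f m + f (suc m)

  record CharZeroDomain : Set (c Level.⊔ ℓ) where
    field
      one≉zero  : ¬ (1# ≈ 0#)
      noZeroDiv : ∀ a b → a * b ≈ 0# → (a ≈ 0#) ⊎ (b ≈ 0#)
      charZero  : ∀ n → natR n ≈ 0# → n ≡ 0

  record PrimitiveRoot (K : ℕ) (ζ : Carrier) : Set ℓ where
    field
      root      : pow ζ K ≈ 1#
      isPrim    : ∀ d → 0 ℕ.< d → d ℕ.< K → ¬ (pow ζ d ≈ 1#)

-- Write L = 2pN and f n = χ(n) ζ^(M n²), where ζ has order 24pN = 12L.  At most one sign vector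
-- (ε₁, ε₂, ε₃) satisfies n ≡ 6p + 3pε₁ + 2pε₂ + 6ℓε₃ (mod 12p), because ε₂, ε₃ and then ε₁ can be read
-- off from n modulo 3, p and 12p.  Reversing all signs, ε₁ or ε₂ therefore negates χ, which gives
-- χ(-n) = -χ(n), χ(n + 6p) = -χ(n), and χ(n + 4p) = -χ(n) when 3 ∣ n + 2p; moreover χ vanishes on
-- multiples of 2 and of 3.  Together with ζ^(6L) = -1 this yields
--   f(x + 3L) = -f(x),   f(b) = -f(a) when a + b = 6L,   f(n) + f(n + 2L) + f(n + 4L) = 0,
-- the last one because for 3 ∣ N it is a multiple of 1 + ω + ω² with ω a primitive cube root of unity,
-- while for 3 ∤ N one of the three arguments is a multiple of 3 and the other two cancel.
-- Hence f(n + L) = f(n) + f(n + 2L), and f(a) = f(b) when a + b = 3L, so splitting [0, 3L] into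
-- [0, L], (L, 2L] and (2L, 3L] turns the sum into A + (A + A) + A with A = Σ_{[0,L]} f.

module Submission where

open import Defs
open import Data.Integer as ℤ using (ℤ; +_; -[1+_])
open import Level using (Level)
open import Algebra.Bundles using (CommutativeRing)
import Algebra.Solver.CommutativeMonoid as CommutativeMonoidSolver
open import Data.Nat as ℕ using (ℕ; zero; suc)
import Data.Nat.Properties as ℕ
open import Relation.Binary.PropositionalEquality as ≡ using (_≡_)
open import Data.Sum using (_⊎_; inj₁; inj₂)
open import Data.Product using (Σ; _,_)
open import Data.Sign as Sign using (Sign)
open import Data.List using (List; []; _∷_)
open import Data.List.Membership.Propositional using (_∈_)
open import Data.List.Relation.Unary.Any as Any using (here; there; any?; satisfied)
open import Data.Maybe using (Maybe; maybe; just; nothing)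
open import Data.Nat.Coprimality as Coprime using (Coprime; coprime-divisor)
open import Relation.Unary as U using (Pred)
open import Data.Fin using (zero; suc)
import Data.Nat.Divisibility as ℕ
open import Data.Nat.DivMod using (DivMod; _divMod_; result)
open import Data.Empty using (⊥-elim)
open import Relation.Nullary using (¬_; yes; no)
import Relation.Nullary.Decidable as Dec
import Data.Integer.Properties as ℤ

module Sums {c ℓ : Level} (R : CommutativeRing c ℓ) where
  open import Data.Nat.Tactic.RingSolver using (solve-∀)
  open CommutativeRing R
  open import Algebra.Properties.Monoid.Mult +-monoid using (_×_; ×-congʳ)
  open CommutativeMonoidSolver +-commutativeMonoid using (solve; _⊕_; _⊜_; id)
  open import Relation.Binary.Reasoning.Setoid setoid

  sumBelow : (ℕ → Carrier) → ℕ → Carrier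
  sumBelow g zero    = 0#
  sumBelow g (suc k) = sumBelow g k + g k

  sumTo≈sumBelow : ∀ f m → sumTo R f m ≈ sumBelow f (suc m)
  sumTo≈sumBelow f zero    = sym (+-identityˡ _)
  sumTo≈sumBelow f (suc m) = +-congʳ (sumTo≈sumBelow f m)

  sumBelow-cong : ∀ {g h} k → (∀ i → g i ≈ h i) → sumBelow g k ≈ sumBelow h k
  sumBelow-cong zero    g≈h = refl
  sumBelow-cong (suc k) g≈h = +-cong (sumBelow-cong k g≈h) (g≈h k)

  sumBelow-+ : ∀ g a b → sumBelow g (a ℕ.+ b) ≈ sumBelow g a + sumBelow (λ i → g (a ℕ.+ i)) b
  sumBelow-+ g a zero    = trans (reflexive (≡.cong (sumBelow g) (ℕ.+-identityʳ a))) (sym (+-identityʳ _))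
  sumBelow-+ g a (suc b) = trans (reflexive (≡.cong (sumBelow g) (ℕ.+-suc a b)))
                                 (trans (+-congʳ (sumBelow-+ g a b)) (+-assoc _ _ _))

  sumBelow-distrib-+ : ∀ g h k → sumBelow (λ i → g i + h i) k ≈ sumBelow g k + sumBelow h k
  sumBelow-distrib-+ g h zero    = sym (+-identityˡ 0#)
  sumBelow-distrib-+ g h (suc k) = begin
    sumBelow (λ i → g i + h i) k + (g k + h k)    ≈⟨ +-congʳ (sumBelow-distrib-+ g h k) ⟩
    (sumBelow g k + sumBelow h k) + (g k + h k)    ≈⟨ solve 4 (λ a b c d → (a ⊕ b) ⊕ (c ⊕ d) ⊜ (a ⊕ c) ⊕ (b ⊕ d)) refl
                                                             (sumBelow g k) (sumBelow h k) (g k) (h k) ⟩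
    (sumBelow g k + g k) + (sumBelow h k + h k)    ∎

  sumBelow-suc : ∀ g k → sumBelow g (suc k) ≈ g 0 + sumBelow (λ i → g (suc i)) k
  sumBelow-suc g zero    = trans (+-identityˡ _) (sym (+-identityʳ _))
  sumBelow-suc g (suc k) = trans (+-congʳ (sumBelow-suc g k)) (+-assoc _ _ _)

  sumBelow-reverse : ∀ {g h} k → (∀ i j → suc (i ℕ.+ j) ≡ k → g i ≈ h j) → sumBelow g k ≈ sumBelow h k
  sumBelow-reverse zero    _ = refl
  sumBelow-reverse {g} {h} (suc k) g≈h = begin
    sumBelow g k + g k                   ≈⟨ +-cong (sumBelow-reverse k λ i j i+j+1≡k → g≈h i (suc j) (shift i j i+j+1≡k))
                                                   (g≈h k 0 (≡.cong suc (ℕ.+-identityʳ k))) ⟩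
    sumBelow (λ j → h (suc j)) k + h 0   ≈⟨ +-comm _ _ ⟩
    h 0 + sumBelow (λ j → h (suc j)) k   ≈⟨ sumBelow-suc h k ⟨
    sumBelow h (suc k)                   ∎
    where
    shift : ∀ i j → suc (i ℕ.+ j) ≡ k → suc (i ℕ.+ suc j) ≡ suc k
    shift i j i+j+1≡k = ≡.cong suc (≡.trans (ℕ.+-suc i j) i+j+1≡k)

  natR*≈× : ∀ n x → natR R n * x ≈ n × x
  natR*≈× zero    x = zeroˡ x
  natR*≈× (suc n) x = trans (distribʳ x 1# (natR R n)) (+-cong (*-identityˡ x) (natR*≈× n x))

  sumTo[3L]≈4×sumTo[L] : ∀ (f : ℕ → Carrier) L → f 0 ≈ 0# → f L ≈ 0# →
    (∀ n → f (n ℕ.+ L) ≈ f n + f (n ℕ.+ 2 ℕ.* L)) → (∀ a b → a ℕ.+ b ≡ 3 ℕ.* L → f a ≈ f b) →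
    sumTo R f (3 ℕ.* L) ≈ 4 × sumTo R f L
  sumTo[3L]≈4×sumTo[L] f L f0≈0 fL≈0 middle reflect = begin
    sumTo R f (3 ℕ.* L)                    ≈⟨ sumTo≈sumBelow f (3 ℕ.* L) ⟩
    sumBelow f (suc (3 ℕ.* L))             ≡⟨ ≡.cong (sumBelow f) (split L) ⟩
    sumBelow f (suc L ℕ.+ L ℕ.+ L)         ≈⟨ trans (sumBelow-+ f (suc L ℕ.+ L) L) (+-congʳ (sumBelow-+ f (suc L) L)) ⟩
    A + second + third                     ≈⟨ +-cong (+-congˡ second≈B+C) third≈C ⟩
    A + (B + C) + C                        ≈⟨ +-cong (+-congˡ (+-cong B≈A C≈A)) C≈A ⟩
    A + (A + A) + A                        ≈⟨ fourfold A ⟩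
    4 × A                                  ≈⟨ ×-congʳ 4 (sumTo≈sumBelow f L) ⟨
    4 × sumTo R f L                        ∎
    where
    split : ∀ L → suc (3 ℕ.* L) ≡ suc L ℕ.+ L ℕ.+ L
    split = solve-∀

    fourfold : ∀ x → x + (x + x) + x ≈ 4 × x
    fourfold = solve 1 (λ a → (a ⊕ (a ⊕ a)) ⊕ a ⊜ a ⊕ (a ⊕ (a ⊕ (a ⊕ id)))) refl

    A B C second third : Carrier
    A      = sumBelow f (suc L)
    B      = sumBelow (λ i → f (suc i)) L
    C      = sumBelow (λ i → f (suc i ℕ.+ 2 ℕ.* L)) L
    second = sumBelow (λ i → f (suc L ℕ.+ i)) L
    third  = sumBelow (λ i → f (suc L ℕ.+ L ℕ.+ i)) L

    second≈B+C : second ≈ B + C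
    second≈B+C = trans (sumBelow-cong L λ i → trans (reflexive (≡.cong f (≡.cong suc (ℕ.+-comm L i)))) (middle (suc i)))
                       (sumBelow-distrib-+ _ _ L)

    third≈C : third ≈ C
    third≈C = sumBelow-cong L λ i → reflexive (≡.cong f (shift L i))
      where
      shift : ∀ L i → suc L ℕ.+ L ℕ.+ i ≡ suc i ℕ.+ 2 ℕ.* L
      shift = solve-∀

    B≈A : B ≈ A
    B≈A = sym (trans (sumBelow-suc f L) (trans (+-congʳ f0≈0) (+-identityˡ B)))

    C≈A : C ≈ A
    C≈A = begin
      C                   ≈⟨ sumBelow-reverse L (λ i j i+j+1≡L → reflect _ j (mirrored i j i+j+1≡L)) ⟩
      sumBelow f L        ≈⟨ +-identityʳ _ ⟨
      sumBelow f L + 0#   ≈⟨ +-congˡ fL≈0 ⟨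
      A                   ∎
      where
      regroup : ∀ i j L → suc i ℕ.+ 2 ℕ.* L ℕ.+ j ≡ suc (i ℕ.+ j) ℕ.+ 2 ℕ.* L
      regroup = solve-∀
      mirrored : ∀ i j → suc (i ℕ.+ j) ≡ L → suc i ℕ.+ 2 ℕ.* L ℕ.+ j ≡ 3 ℕ.* L
      mirrored i j i+j+1≡L = ≡.trans (regroup i j L) (≡.cong (λ k → k ℕ.+ 2 ℕ.* L) i+j+1≡L)

module RingLemmas {c ℓ : Level} (R : CommutativeRing c ℓ) where
  open import Data.Nat.Tactic.RingSolver using (solve-∀)
  open CommutativeRing R
  open import Algebra.Properties.Semiring.Exp semiring public using (_^_; ^-homo-*; ^-congʳ)
  open import Algebra.Properties.Ring ring using ([y-z]x≈yx-zx; -0#≈0#)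
  open import Algebra.Properties.Group +-group using (inverseˡ-unique; x∙y⁻¹≈ε⇒x≈y; ⁻¹-involutive)
  open import Algebra.Properties.AbelianGroup +-abelianGroup using (⁻¹-∙-comm)
  open CommutativeMonoidSolver +-commutativeMonoid using (solve; _⊕_; _⊜_)
  open import Relation.Binary.Reasoning.Setoid setoid

  pow≡^ : ∀ x n → pow R x n ≡ x ^ n
  pow≡^ x zero    = ≡.refl
  pow≡^ x (suc n) = ≡.cong (x *_) (pow≡^ x n)

  module _ {x : Carrier} {K : ℕ} (x^K≈1 : x ^ K ≈ 1#) where

    ^-periodic : ∀ m s → x ^ (m ℕ.+ K ℕ.* s) ≈ x ^ m
    ^-periodic m zero    = ^-congʳ x (≡.trans (≡.cong (m ℕ.+_) (ℕ.*-zeroʳ K)) (ℕ.+-identityʳ m))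
    ^-periodic m (suc s) = begin
      x ^ (m ℕ.+ K ℕ.* suc s)        ≡⟨ ≡.cong (x ^_) (regroup m K s) ⟩
      x ^ (m ℕ.+ K ℕ.* s ℕ.+ K)      ≈⟨ ^-homo-* x (m ℕ.+ K ℕ.* s) K ⟩
      x ^ (m ℕ.+ K ℕ.* s) * x ^ K    ≈⟨ *-cong (^-periodic m s) x^K≈1 ⟩
      x ^ m * 1#                     ≈⟨ *-identityʳ _ ⟩
      x ^ m                          ∎
      where
      regroup : ∀ m K s → m ℕ.+ K ℕ.* suc s ≡ m ℕ.+ K ℕ.* s ℕ.+ K
      regroup = solve-∀

    ^-cong-mod : ∀ {m n} s t → m ℕ.+ K ℕ.* s ≡ n ℕ.+ K ℕ.* t → x ^ m ≈ x ^ n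
    ^-cong-mod {m} {n} s t eq = begin
      x ^ m                ≈⟨ ^-periodic m s ⟨
      x ^ (m ℕ.+ K ℕ.* s)  ≡⟨ ≡.cong (x ^_) eq ⟩
      x ^ (n ℕ.+ K ℕ.* t)  ≈⟨ ^-periodic n t ⟩
      x ^ n                ∎

  intR-neg : ∀ z → intR R (ℤ.- z) ≈ - intR R z
  intR-neg (+ zero)  = sym -0#≈0#
  intR-neg (+ suc n) = refl
  intR-neg -[1+ n ]  = sym (⁻¹-involutive _)

  [x-1]y≈xy-y : ∀ x y → (x - 1#) * y ≈ x * y - y
  [x-1]y≈xy-y x y = trans ([y-z]x≈yx-zx y x 1#) (+-congˡ (-‿cong (*-identityˡ y)))

  [a+b]-[b+c]≈a-c : ∀ a b c → (a + b) - (b + c) ≈ a - c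
  [a+b]-[b+c]≈a-c a b c = begin
    (a + b) - (b + c)          ≈⟨ +-congˡ (⁻¹-∙-comm b c) ⟨
    (a + b) + (- b + - c)      ≈⟨ solve 4 (λ a b b′ c′ → (a ⊕ b) ⊕ (b′ ⊕ c′) ⊜ (a ⊕ c′) ⊕ (b ⊕ b′)) refl a b (- b) (- c) ⟩
    (a - c) + (b - b)          ≈⟨ +-congˡ (-‿inverseʳ b) ⟩
    (a - c) + 0#               ≈⟨ +-identityʳ _ ⟩
    a - c                      ∎

  a[1+x+x²]≈a+ax+ax² : ∀ a x → a * (1# + x + x * x) ≈ a + a * x + a * (x * x)
  a[1+x+x²]≈a+ax+ax² a x = trans (distribˡ a (1# + x) (x * x)) (+-congʳ (trans (distribˡ a 1# x) (+-congʳ (*-identityʳ a))))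

  module _ (noZeroDivisors : ∀ a b → a * b ≈ 0# → a ≈ 0# ⊎ b ≈ 0#) where

    square≈1⇒≈-1 : ∀ x → x * x ≈ 1# → ¬ x ≈ 1# → x ≈ - 1#
    square≈1⇒≈-1 x x²≈1 x≉1 with noZeroDivisors (x - 1#) (x + 1#) factorisation
      where
      factorisation : (x - 1#) * (x + 1#) ≈ 0#
      factorisation = begin
        (x - 1#) * (x + 1#)        ≈⟨ [x-1]y≈xy-y x (x + 1#) ⟩
        x * (x + 1#) - (x + 1#)    ≈⟨ +-congʳ (trans (distribˡ x x 1#) (+-congˡ (*-identityʳ x))) ⟩
        (x * x + x) - (x + 1#)     ≈⟨ [a+b]-[b+c]≈a-c (x * x) x 1# ⟩
        x * x - 1#                 ≈⟨ +-congʳ x²≈1 ⟩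
        1# - 1#                    ≈⟨ -‿inverseʳ 1# ⟩
        0#                         ∎
    ... | inj₁ x-1≈0 = ⊥-elim (x≉1 (x∙y⁻¹≈ε⇒x≈y x 1# x-1≈0))
    ... | inj₂ x+1≈0 = inverseˡ-unique x 1# x+1≈0

    cube≈1⇒1+x+x²≈0 : ∀ x → x * (x * x) ≈ 1# → ¬ x ≈ 1# → 1# + x + x * x ≈ 0#
    cube≈1⇒1+x+x²≈0 x x³≈1 x≉1 with noZeroDivisors (x - 1#) (1# + x + x * x) factorisation
      where
      factorisation : (x - 1#) * (1# + x + x * x) ≈ 0#
      factorisation = begin
        (x - 1#) * (1# + x + x * x)                       ≈⟨ [x-1]y≈xy-y x _ ⟩
        x * (1# + x + x * x) - (1# + x + x * x)            ≈⟨ +-cong expand (-‿cong (solve 3 (λ a b c → (a ⊕ b) ⊕ c ⊜ (b ⊕ c) ⊕ a) refl 1# x (x * x))) ⟩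
        (x * (x * x) + (x + x * x)) - ((x + x * x) + 1#)   ≈⟨ [a+b]-[b+c]≈a-c (x * (x * x)) (x + x * x) 1# ⟩
        x * (x * x) - 1#                                  ≈⟨ +-congʳ x³≈1 ⟩
        1# - 1#                                           ≈⟨ -‿inverseʳ 1# ⟩
        0#                                                ∎
        where
        expand : x * (1# + x + x * x) ≈ x * (x * x) + (x + x * x)
        expand = begin
          x * (1# + x + x * x)              ≈⟨ distribˡ x (1# + x) (x * x) ⟩
          x * (1# + x) + x * (x * x)        ≈⟨ +-congʳ (trans (distribˡ x 1# x) (+-congʳ (*-identityʳ x))) ⟩
          (x + x * x) + x * (x * x)         ≈⟨ +-comm _ _ ⟩
          x * (x * x) + (x + x * x)         ∎
    ... | inj₁ x-1≈0        = ⊥-elim (x≉1 (x∙y⁻¹≈ε⇒x≈y x 1# x-1≈0))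
    ... | inj₂ 1+x+x²≈0     = 1+x+x²≈0

3∤remainder : ∀ {n q r} → n ≡ r ℕ.+ q ℕ.* 3 → 0 ℕ.< r → r ℕ.< 3 → ¬ 3 ℕ.∣ n
3∤remainder {n} {q} {r} n≡r+3q 0<r r<3 3∣n =
  ℕ.<⇒≱ r<3 (ℕ.∣⇒≤ {{ℕ.>-nonZero 0<r}} (ℕ.∣m+n∣m⇒∣n 3∣3q+r (ℕ.n∣m*n q)))
  where
  3∣3q+r : 3 ℕ.∣ q ℕ.* 3 ℕ.+ r
  3∣3q+r = ≡.subst (3 ℕ.∣_) (≡.trans n≡r+3q (ℕ.+-comm r (q ℕ.* 3))) 3∣n

module Shifts {c ℓ : Level} (R : CommutativeRing c ℓ) where
  open import Data.Nat.Tactic.RingSolver using (solve-∀)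
  open CommutativeRing R
  open CommutativeMonoidSolver +-commutativeMonoid using (solve; _⊕_; _⊜_)
  open import Relation.Binary.Reasoning.Setoid setoid

  three-shifts-cancel : ∀ (g : ℕ → Carrier) d → ¬ 3 ℕ.∣ d →
    (∀ x → g (x ℕ.+ 3 ℕ.* d) ≈ g x) → (∀ u → g (3 ℕ.* u) ≈ 0#) →
    (∀ u → g (3 ℕ.* u ℕ.+ d) + g (3 ℕ.* u ℕ.+ 2 ℕ.* d) ≈ 0#) →
    ∀ n → g n + g (n ℕ.+ d) + g (n ℕ.+ 2 ℕ.* d) ≈ 0#
  three-shifts-cancel g d 3∤d periodic vanish pair n = shift-to-multiple-of-3 reach-multiple-of-3
    where
    triple : ℕ → Carrier
    triple m = g m + g (m ℕ.+ d) + g (m ℕ.+ 2 ℕ.* d)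

    triple-shift : ∀ m → triple (m ℕ.+ d) ≈ triple m
    triple-shift m = begin
      g (m ℕ.+ d) + g (m ℕ.+ d ℕ.+ d) + g (m ℕ.+ d ℕ.+ 2 ℕ.* d)
        ≈⟨ +-cong (+-congˡ (reflexive (≡.cong g (twice m d)))) (trans (reflexive (≡.cong g (thrice m d))) (periodic m)) ⟩
      g (m ℕ.+ d) + g (m ℕ.+ 2 ℕ.* d) + g m
        ≈⟨ solve 3 (λ a b c → (b ⊕ c) ⊕ a ⊜ (a ⊕ b) ⊕ c) refl (g m) (g (m ℕ.+ d)) (g (m ℕ.+ 2 ℕ.* d)) ⟩
      triple m ∎
      where
      twice : ∀ m d → m ℕ.+ d ℕ.+ d ≡ m ℕ.+ 2 ℕ.* d
      twice = solve-∀
      thrice : ∀ m d → m ℕ.+ d ℕ.+ 2 ℕ.* d ≡ m ℕ.+ 3 ℕ.* d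
      thrice = solve-∀

    triple-shifts : ∀ m j → triple (m ℕ.+ j ℕ.* d) ≈ triple m
    triple-shifts m zero    = reflexive (≡.cong triple (ℕ.+-identityʳ m))
    triple-shifts m (suc j) = trans (reflexive (≡.cong triple (regroup m j d)))
                                    (trans (triple-shift (m ℕ.+ j ℕ.* d)) (triple-shifts m j))
      where
      regroup : ∀ m j d → m ℕ.+ suc j ℕ.* d ≡ m ℕ.+ j ℕ.* d ℕ.+ d
      regroup = solve-∀

    reach-multiple-of-3 : Σ ℕ λ j → Σ ℕ λ u → n ℕ.+ j ℕ.* d ≡ 3 ℕ.* u
    reach-multiple-of-3 with d divMod 3
    ... | result q zero          d≡3q   = ⊥-elim (3∤d (ℕ.divides q d≡3q))
    ... | result q (suc zero)    d≡1+3q = 2 ℕ.* n , n ℕ.+ 2 ℕ.* n ℕ.* q , ≡.trans (≡.cong (λ d → n ℕ.+ 2 ℕ.* n ℕ.* d) d≡1+3q) (step n q)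
      where
      step : ∀ n q → n ℕ.+ 2 ℕ.* n ℕ.* (1 ℕ.+ q ℕ.* 3) ≡ 3 ℕ.* (n ℕ.+ 2 ℕ.* n ℕ.* q)
      step = solve-∀
    ... | result q (suc (suc zero)) d≡2+3q = n , n ℕ.+ n ℕ.* q , ≡.trans (≡.cong (λ d → n ℕ.+ n ℕ.* d) d≡2+3q) (step n q)
      where
      step : ∀ n q → n ℕ.+ n ℕ.* (2 ℕ.+ q ℕ.* 3) ≡ 3 ℕ.* (n ℕ.+ n ℕ.* q)
      step = solve-∀

    shift-to-multiple-of-3 : (Σ ℕ λ j → Σ ℕ λ u → n ℕ.+ j ℕ.* d ≡ 3 ℕ.* u) → triple n ≈ 0#
    shift-to-multiple-of-3 (j , u , n+jd≡3u) = begin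
      triple n                                   ≈⟨ triple-shifts n j ⟨
      triple (n ℕ.+ j ℕ.* d)                     ≡⟨ ≡.cong triple n+jd≡3u ⟩
      g (3 ℕ.* u) + g (3 ℕ.* u ℕ.+ d) + g (3 ℕ.* u ℕ.+ 2 ℕ.* d)   ≈⟨ +-assoc _ _ _ ⟩
      g (3 ℕ.* u) + (g (3 ℕ.* u ℕ.+ d) + g (3 ℕ.* u ℕ.+ 2 ℕ.* d)) ≈⟨ +-cong (vanish u) (pair u) ⟩
      0# + 0#                                    ≈⟨ +-identityʳ 0# ⟩
      0#                                         ∎

-- Data.List.find, except that it branches on the decision P? x itself rather than on its `does`
-- field, as Defs.chi does; this is what lets chi≡firstMatch replay the case analysis of chi.
module FirstMatch {a p : Level} {A : Set a} {P : Pred A p} (P? : U.Decidable P) where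

  firstMatch : List A → Maybe A
  firstMatch []       = nothing
  firstMatch (x ∷ xs) with P? x
  ... | yes _ = just x
  ... | no  _ = firstMatch xs

  firstMatch≡nothing : ∀ xs → (∀ x → ¬ P x) → firstMatch xs ≡ nothing
  firstMatch≡nothing []       _  = ≡.refl
  firstMatch≡nothing (y ∷ ys) ¬P with P? y
  ... | yes Py = ⊥-elim (¬P y Py)
  ... | no  _  = firstMatch≡nothing ys ¬P

  firstMatch≡just : (∀ {x y} → P x → P y → x ≡ y) → ∀ {x xs} → P x → x ∈ xs → firstMatch xs ≡ just x
  firstMatch≡just unique {x} {y ∷ ys} Px x∈y∷ys with P? y | x∈y∷ys
  ... | yes Py | _            = ≡.cong just (unique Py Px)
  ... | no ¬Py | here ≡.refl  = ⊥-elim (¬Py Px)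
  ... | no  _  | there x∈ys   = firstMatch≡just unique Px x∈ys

module Chi (p ℓ : ℕ) (6⊥p : Coprime 6 p) (0<ℓ : 0 ℕ.< ℓ) (ℓ<p : ℓ ℕ.< p) where
  open import Data.Product using (_×_)
  open import Data.Integer using (_+_; _*_; _-_; -_)
  open import Data.Integer.Divisibility.Signed
  open import Data.Integer.Tactic.RingSolver using (solve-∀)
  open FirstMatch using (firstMatch; firstMatch≡nothing; firstMatch≡just)

  χ : ℤ → ℤ
  χ = chi 2 3 p 1 1 ℓ

  Signs : Set
  Signs = Sign × Sign × Sign

  σ : Sign → ℤ
  σ Sign.+ = + 1
  σ Sign.- = - + 1

  σ-opposite : ∀ s → σ (Sign.opposite s) ≡ - σ s
  σ-opposite Sign.+ = ≡.refl
  σ-opposite Sign.- = ≡.refl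

  value : Signs → ℤ
  value (s₁ , s₂ , s₃) = - (σ s₁ * σ s₂ * σ s₃)

  allSigns : List Signs
  allSigns = (Sign.+ , Sign.+ , Sign.+) ∷ (Sign.+ , Sign.+ , Sign.-) ∷ (Sign.+ , Sign.- , Sign.+) ∷ (Sign.+ , Sign.- , Sign.-)
           ∷ (Sign.- , Sign.+ , Sign.+) ∷ (Sign.- , Sign.+ , Sign.-) ∷ (Sign.- , Sign.- , Sign.+) ∷ (Sign.- , Sign.- , Sign.-) ∷ []

  ∈-allSigns : ∀ e → e ∈ allSigns
  ∈-allSigns (Sign.+ , Sign.+ , Sign.+) = here ≡.refl
  ∈-allSigns (Sign.+ , Sign.+ , Sign.-) = there (here ≡.refl)
  ∈-allSigns (Sign.+ , Sign.- , Sign.+) = there (there (here ≡.refl))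
  ∈-allSigns (Sign.+ , Sign.- , Sign.-) = there (there (there (here ≡.refl)))
  ∈-allSigns (Sign.- , Sign.+ , Sign.+) = there (there (there (there (here ≡.refl))))
  ∈-allSigns (Sign.- , Sign.+ , Sign.-) = there (there (there (there (there (here ≡.refl)))))
  ∈-allSigns (Sign.- , Sign.- , Sign.+) = there (there (there (there (there (there (here ≡.refl))))))
  ∈-allSigns (Sign.- , Sign.- , Sign.-) = there (there (there (there (there (there (there (here ≡.refl)))))))

  pℤ ℓℤ modulus : ℤ
  pℤ = + p
  ℓℤ = + ℓ
  modulus = + 12 * pℤ

  -- centre (ε₁ , ε₂ , ε₃) = P (1 + ε₁/2 + ε₂/3 + ε₃ℓ/p) with P = 6p.
  centre : Signs → ℤ
  centre (s₁ , s₂ , s₃) = + 6 * pℤ + σ s₁ * (+ 3 * pℤ) + σ s₂ * (+ 2 * pℤ) + σ s₃ * (+ 6 * ℓℤ)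

  record Matches (n : ℤ) (e : Signs) : Set where
    constructor matches
    field divisible : modulus ∣ n - centre e
  open Matches

  matches? : ∀ n → U.Decidable (Matches n)
  matches? n e = Dec.map′ matches divisible (modulus ∣? (n - centre e))

  -- The divisibility test of Defs.chi, in the unnormalised form in which it is written there.
  private
    defsModulus : ℤ
    defsModulus = + (2 ℕ.* (2 ℕ.* 3 ℕ.* p))

    defsCentre : Signs → ℤ
    defsCentre (s₁ , s₂ , s₃) =
      + (2 ℕ.* 3 ℕ.* p) + σ s₁ * + (1 ℕ.* 3 ℕ.* p) + σ s₂ * + (1 ℕ.* 2 ℕ.* p) + σ s₃ * + (ℓ ℕ.* 2 ℕ.* 3)

    defsMatches? : ∀ n → U.Decidable (λ e → defsModulus ∣ n - defsCentre e)
    defsMatches? n e = defsModulus ∣? (n - defsCentre e)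

    defsModulus≡modulus : defsModulus ≡ modulus
    defsModulus≡modulus = ≡.trans (≡.cong +_ (≡.sym (ℕ.*-assoc 2 6 p))) (ℤ.pos-* 12 p)

    defsCentre≡centre : ∀ e → defsCentre e ≡ centre e
    defsCentre≡centre (s₁ , s₂ , s₃) =
      ≡.cong₂ _+_ (≡.cong₂ _+_ (≡.cong₂ _+_ (ℤ.pos-* 6 p) (≡.cong (σ s₁ *_) (ℤ.pos-* 3 p)))
                               (≡.cong (σ s₂ *_) (ℤ.pos-* 2 p)))
                  (≡.cong (σ s₃ *_) (≡.trans (≡.cong +_ (≡.trans (ℕ.*-assoc ℓ 2 3) (ℕ.*-comm ℓ 6))) (ℤ.pos-* 6 ℓ)))

    chi≡firstMatch : ∀ n → χ n ≡ maybe value (+ 0) (firstMatch (defsMatches? n) allSigns)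
    chi≡firstMatch n with defsMatches? n (Sign.+ , Sign.+ , Sign.+)
    ... | yes _ = ≡.refl
    ... | no  _ with defsMatches? n (Sign.+ , Sign.+ , Sign.-)
    ... | yes _ = ≡.refl
    ... | no  _ with defsMatches? n (Sign.+ , Sign.- , Sign.+)
    ... | yes _ = ≡.refl
    ... | no  _ with defsMatches? n (Sign.+ , Sign.- , Sign.-)
    ... | yes _ = ≡.refl
    ... | no  _ with defsMatches? n (Sign.- , Sign.+ , Sign.+)
    ... | yes _ = ≡.refl
    ... | no  _ with defsMatches? n (Sign.- , Sign.+ , Sign.-)
    ... | yes _ = ≡.refl
    ... | no  _ with defsMatches? n (Sign.- , Sign.- , Sign.+)
    ... | yes _ = ≡.refl
    ... | no  _ with defsMatches? n (Sign.- , Sign.- , Sign.-)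
    ... | yes _ = ≡.refl
    ... | no  _ = ≡.refl

    fromDefs : ∀ n e → defsModulus ∣ n - defsCentre e → Matches n e
    fromDefs n e d = matches (≡.subst₂ (λ m c → m ∣ n - c) defsModulus≡modulus (defsCentre≡centre e) d)

    toDefs : ∀ n e → Matches n e → defsModulus ∣ n - defsCentre e
    toDefs n e m = ≡.subst₂ (λ m c → m ∣ n - c) (≡.sym defsModulus≡modulus) (≡.sym (defsCentre≡centre e)) (divisible m)

  2∤p : ¬ 2 ℕ.∣ p
  2∤p 2∣p with 6⊥p (ℕ.divides 3 ≡.refl , 2∣p)
  ... | ()

  3∤p : ¬ 3 ℕ.∣ p
  3∤p 3∣p with 6⊥p (ℕ.divides 2 ≡.refl , 3∣p)
  ... | ()

  p∤ℓ : ¬ p ℕ.∣ ℓ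
  p∤ℓ = ℕ.>⇒∤ {{ℕ.>-nonZero 0<ℓ}} ℓ<p

  instance
    p≢0 : ℕ.NonZero p
    p≢0 = ℕ.>-nonZero (ℕ.<-trans 0<ℓ ℓ<p)

  -- Modulo 2, 3 and p, a match n ≡ centre e only remembers ε₁, ε₂ and ε₃ respectively.
  private
    residue : ∀ {d n e} r q → d ∣ modulus → Matches n e → n - r ≡ (n - centre e) + q * d → d ∣ n - r
    residue {d} r q d∣modulus n≡centre eq =
      ≡.subst (d ∣_) (≡.sym eq) (∣m∣n⇒∣m+n (∣-trans d∣modulus (divisible n≡centre)) (divides q ≡.refl))

  residue₁ : ∀ {n s₁ s₂ s₃} → Matches n (s₁ , s₂ , s₃) → + 2 ∣ n - σ s₁ * (+ 3 * pℤ)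
  residue₁ {n} {s₁} {s₂} {s₃} m = residue _ (+ 3 * pℤ + σ s₂ * pℤ + + 3 * σ s₃ * ℓℤ)
    (divides (+ 6 * pℤ) (12p≡6p*2 pℤ)) m (identity n (σ s₁) (σ s₂) (σ s₃) pℤ ℓℤ)
    where
    12p≡6p*2 : ∀ p → + 12 * p ≡ + 6 * p * + 2
    12p≡6p*2 = solve-∀
    identity : ∀ n a b c p l → n - a * (+ 3 * p)
      ≡ (n - (+ 6 * p + a * (+ 3 * p) + b * (+ 2 * p) + c * (+ 6 * l))) + (+ 3 * p + b * p + + 3 * c * l) * + 2
    identity = solve-∀

  residue₂ : ∀ {n s₁ s₂ s₃} → Matches n (s₁ , s₂ , s₃) → + 3 ∣ n - σ s₂ * (+ 2 * pℤ)
  residue₂ {n} {s₁} {s₂} {s₃} m = residue _ (+ 2 * pℤ + σ s₁ * pℤ + + 2 * σ s₃ * ℓℤ)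
    (divides (+ 4 * pℤ) (12p≡4p*3 pℤ)) m (identity n (σ s₁) (σ s₂) (σ s₃) pℤ ℓℤ)
    where
    12p≡4p*3 : ∀ p → + 12 * p ≡ + 4 * p * + 3
    12p≡4p*3 = solve-∀
    identity : ∀ n a b c p l → n - b * (+ 2 * p)
      ≡ (n - (+ 6 * p + a * (+ 3 * p) + b * (+ 2 * p) + c * (+ 6 * l))) + (+ 2 * p + a * p + + 2 * c * l) * + 3
    identity = solve-∀

  residue₃ : ∀ {n s₁ s₂ s₃} → Matches n (s₁ , s₂ , s₃) → pℤ ∣ n - σ s₃ * (+ 6 * ℓℤ)
  residue₃ {n} {s₁} {s₂} {s₃} m = residue _ (+ 6 + + 3 * σ s₁ + + 2 * σ s₂)
    (divides (+ 12) ≡.refl) m (identity n (σ s₁) (σ s₂) (σ s₃) pℤ ℓℤ)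
    where
    identity : ∀ n a b c p l → n - c * (+ 6 * l)
      ≡ (n - (+ 6 * p + a * (+ 3 * p) + b * (+ 2 * p) + c * (+ 6 * l))) + (+ 6 + + 3 * a + + 2 * b) * p
    identity = solve-∀

  centre₂₃ : Sign → Sign → ℤ
  centre₂₃ s₂ s₃ = + 6 * pℤ + σ s₂ * (+ 2 * pℤ) + σ s₃ * (+ 6 * ℓℤ)

  residue₁₂₃ : ∀ {n s₁ s₂ s₃} → Matches n (s₁ , s₂ , s₃) → modulus ∣ (n - centre₂₃ s₂ s₃) - σ s₁ * (+ 3 * pℤ)
  residue₁₂₃ {n} {s₁} {s₂} {s₃} m = ≡.subst (modulus ∣_) (identity n (σ s₁) (σ s₂) (σ s₃) pℤ ℓℤ) (divisible m)
    where
    identity : ∀ n a b c p l → n - (+ 6 * p + a * (+ 3 * p) + b * (+ 2 * p) + c * (+ 6 * l))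
      ≡ (n - (+ 6 * p + b * (+ 2 * p) + c * (+ 6 * l))) - a * (+ 3 * p)
    identity = solve-∀

  3∤4p : ¬ + 3 ∣ + 2 * (+ 2 * pℤ)
  3∤4p 3∣4p = 3∤p (∣⇒∣ᵤ (≡.subst (+ 3 ∣_) (4p-3p≡p pℤ) (∣m∣n⇒∣m-n 3∣4p (divides pℤ (ℤ.*-comm (+ 3) pℤ)))))
    where
    4p-3p≡p : ∀ p → + 2 * (+ 2 * p) - + 3 * p ≡ p
    4p-3p≡p = solve-∀

  3∤2p : ¬ + 3 ∣ + 2 * pℤ
  3∤2p 3∣2p = 3∤p (∣⇒∣ᵤ (≡.subst (+ 3 ∣_) (3p-2p≡p pℤ) (∣m∣n⇒∣m-n (divides pℤ (ℤ.*-comm (+ 3) pℤ)) 3∣2p)))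
    where
    3p-2p≡p : ∀ p → + 3 * p - + 2 * p ≡ p
    3p-2p≡p = solve-∀

  2∤3p : ¬ + 2 ∣ + 3 * pℤ
  2∤3p 2∣3p = 2∤p (∣⇒∣ᵤ (≡.subst (+ 2 ∣_) (3p-2p≡p pℤ) (∣m∣n⇒∣m-n 2∣3p (divides pℤ (ℤ.*-comm (+ 2) pℤ)))))
    where
    3p-2p≡p : ∀ p → + 3 * p - + 2 * p ≡ p
    3p-2p≡p = solve-∀

  p∤12ℓ : ¬ pℤ ∣ + 2 * (+ 6 * ℓℤ)
  p∤12ℓ p∣12ℓ = p∤ℓ (coprime-divisor (Coprime.sym 6⊥p) (coprime-divisor p⊥2 p∣2[6ℓ]))
    where
    p⊥2 : Coprime p 2
    p⊥2 (d∣p , d∣2) = 6⊥p (ℕ.∣-trans d∣2 (ℕ.divides 3 ≡.refl) , d∣p)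
    p∣2[6ℓ] : p ℕ.∣ 2 ℕ.* (6 ℕ.* ℓ)
    p∣2[6ℓ] = ≡.subst (p ℕ.∣_) (≡.trans (ℤ.abs-* (+ 2) (+ 6 * ℓℤ)) (≡.cong (2 ℕ.*_) (ℤ.abs-* (+ 6) ℓℤ))) (∣⇒∣ᵤ p∣12ℓ)

  12p∤6p : ¬ modulus ∣ + 2 * (+ 3 * pℤ)
  12p∤6p 12p∣6p = ℕ.>⇒∤ (ℕ.m<m+n 6 ℕ.z<s) (∣⇒∣ᵤ (*-cancelʳ-∣ pℤ {+ 12} {+ 6} (≡.subst (modulus ∣_) (6p pℤ) 12p∣6p)))
    where
    6p : ∀ p → + 2 * (+ 3 * p) ≡ + 6 * p
    6p = solve-∀

  sign-unique : ∀ {d} x X s s′ → ¬ d ∣ + 2 * X → d ∣ x - σ s * X → d ∣ x - σ s′ * X → s ≡ s′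
  sign-unique x X Sign.+ Sign.+ _ _ _ = ≡.refl
  sign-unique x X Sign.- Sign.- _ _ _ = ≡.refl
  sign-unique {d} x X Sign.+ Sign.- d∤2X d∣x-X d∣x+X =
    ⊥-elim (d∤2X (≡.subst (d ∣_) (difference x X) (∣m∣n⇒∣m-n d∣x+X d∣x-X)))
    where
    difference : ∀ x X → (x - - + 1 * X) - (x - + 1 * X) ≡ + 2 * X
    difference = solve-∀
  sign-unique x X Sign.- Sign.+ d∤2X d∣x+X d∣x-X = ≡.sym (sign-unique x X Sign.+ Sign.- d∤2X d∣x-X d∣x+X)

  no-sign : ∀ {d} x X s → ¬ d ∣ X → d ∣ x → ¬ d ∣ x - σ s * X
  no-sign {d} x X Sign.+ d∤X d∣x d∣x-X = d∤X (≡.subst (d ∣_) (difference x X) (∣m∣n⇒∣m-n d∣x d∣x-X))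
    where
    difference : ∀ x X → x - (x - + 1 * X) ≡ X
    difference = solve-∀
  no-sign {d} x X Sign.- d∤X d∣x d∣x+X = d∤X (≡.subst (d ∣_) (difference x X) (∣m∣n⇒∣m-n d∣x+X d∣x))
    where
    difference : ∀ x X → (x - - + 1 * X) - x ≡ X
    difference = solve-∀

  matches-unique : ∀ {n e e′} → Matches n e → Matches n e′ → e ≡ e′
  matches-unique {n} {s₁ , s₂ , s₃} {s₁′ , s₂′ , s₃′} m m′
    with sign-unique n _ s₂ s₂′ 3∤4p (residue₂ m) (residue₂ m′)
       | sign-unique n _ s₃ s₃′ p∤12ℓ (residue₃ m) (residue₃ m′)
  ... | ≡.refl | ≡.refl = ≡.cong (_, s₂ , s₃) (sign-unique (n - centre₂₃ s₂ s₃) _ s₁ s₁′ 12p∤6p (residue₁₂₃ m) (residue₁₂₃ m′))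

  χ-match : ∀ {n e} → Matches n e → χ n ≡ value e
  χ-match {n} {e} m = ≡.trans (chi≡firstMatch n) (≡.cong (maybe value (+ 0))
    (firstMatch≡just (defsMatches? n) (λ {x} {y} d d′ → matches-unique (fromDefs n x d) (fromDefs n y d′)) (toDefs n e m) (∈-allSigns e)))

  χ-no-match : ∀ {n} → (∀ e → ¬ Matches n e) → χ n ≡ + 0
  χ-no-match {n} none = ≡.trans (chi≡firstMatch n) (≡.cong (maybe value (+ 0))
    (firstMatch≡nothing (defsMatches? n) allSigns (λ e d → none e (fromDefs n e d))))

  match? : ∀ n → Σ Signs (Matches n) ⊎ (∀ e → ¬ Matches n e)
  match? n with any? (matches? n) allSigns
  ... | yes m = inj₁ (satisfied m)
  ... | no ¬m = inj₂ λ e m → ¬m (Any.map (λ e≡x → ≡.subst (Matches n) e≡x m) (∈-allSigns e))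

  χ-even : ∀ {n} → + 2 ∣ n → χ n ≡ + 0
  χ-even {n} 2∣n = χ-no-match λ { (s₁ , _ , _) m → no-sign n _ s₁ 2∤3p 2∣n (residue₁ m) }

  χ-three : ∀ {n} → + 3 ∣ n → χ n ≡ + 0
  χ-three {n} 3∣n = χ-no-match λ { (_ , s₂ , _) m → no-sign n _ s₂ 3∤2p 3∣n (residue₂ m) }

  χ-negated-by : (π : Signs → Signs) → (∀ e → value (π e) ≡ - value e) → ∀ {a b} →
    (∀ {e} → Matches b e → Matches a (π e)) → (∀ {e} → Matches a e → Matches b (π e)) → χ a ≡ - χ b
  χ-negated-by π value-π {a} {b} forward backward with match? b
  ... | inj₁ (e , m) = begin
    χ a               ≡⟨ χ-match (forward m) ⟩
    value (π e)       ≡⟨ value-π e ⟩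
    - value e       ≡⟨ ≡.cong -_ (χ-match m) ⟨
    - χ b           ∎
    where open ≡.≡-Reasoning
  ... | inj₂ none = ≡.trans (χ-no-match λ e m → none (π e) (backward m)) (≡.cong -_ (≡.sym (χ-no-match none)))

  matches-shift : ∀ {a b k e e′} → modulus ∣ a - (b + k) → Matches b e → modulus ∣ centre e + k - centre e′ → Matches a e′
  matches-shift {a} {b} {k} {e} {e′} a≡b+k m e+k≡e′ = matches (≡.subst (modulus ∣_) (identity a b k (centre e) (centre e′))
    (∣m∣n⇒∣m+n (∣m∣n⇒∣m+n a≡b+k (divisible m)) e+k≡e′))
    where
    identity : ∀ a b k c c′ → a - (b + k) + (b - c) + (c + k - c′) ≡ a - c′
    identity = solve-∀

  negate flip₁ flip₂ : Signs → Signs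
  negate (s₁ , s₂ , s₃) = Sign.opposite s₁ , Sign.opposite s₂ , Sign.opposite s₃
  flip₁  (s₁ , s₂ , s₃) = Sign.opposite s₁ , s₂ , s₃
  flip₂  (s₁ , s₂ , s₃) = s₁ , Sign.opposite s₂ , s₃

  value-negate : ∀ e → value (negate e) ≡ - value e
  value-negate (s₁ , s₂ , s₃) rewrite σ-opposite s₁ | σ-opposite s₂ | σ-opposite s₃ = identity (σ s₁) (σ s₂) (σ s₃)
    where
    identity : ∀ a b c → - (- a * - b * - c) ≡ - - (a * b * c)
    identity = solve-∀

  value-flip₁ : ∀ e → value (flip₁ e) ≡ - value e
  value-flip₁ (s₁ , s₂ , s₃) rewrite σ-opposite s₁ = identity (σ s₁) (σ s₂) (σ s₃)
    where
    identity : ∀ a b c → - (- a * b * c) ≡ - - (a * b * c)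
    identity = solve-∀

  value-flip₂ : ∀ e → value (flip₂ e) ≡ - value e
  value-flip₂ (s₁ , s₂ , s₃) rewrite σ-opposite s₂ = identity (σ s₁) (σ s₂) (σ s₃)
    where
    identity : ∀ a b c → - (a * - b * c) ≡ - - (a * b * c)
    identity = solve-∀

  centre-negate : ∀ e → centre (negate e) ≡ modulus - centre e
  centre-negate (s₁ , s₂ , s₃) rewrite σ-opposite s₁ | σ-opposite s₂ | σ-opposite s₃ = identity (σ s₁) (σ s₂) (σ s₃) pℤ ℓℤ
    where
    identity : ∀ a b c p l → + 6 * p + - a * (+ 3 * p) + - b * (+ 2 * p) + - c * (+ 6 * l)
      ≡ + 12 * p - (+ 6 * p + a * (+ 3 * p) + b * (+ 2 * p) + c * (+ 6 * l))
    identity = solve-∀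

  matches-negate : ∀ {a b e} → modulus ∣ a + b → Matches b e → Matches a (negate e)
  matches-negate {a} {b} {e} a+b≡0 m =
    matches (≡.subst (modulus ∣_) a-centre (∣m∣n⇒∣m-n (∣m∣n⇒∣m-n a+b≡0 (divisible m)) ∣-refl))
    where
    identity : ∀ a b c m → a + b - (b - c) - m ≡ a - (m - c)
    identity = solve-∀
    a-centre : a + b - (b - centre e) - modulus ≡ a - centre (negate e)
    a-centre = ≡.trans (identity a b (centre e) modulus) (≡.cong (λ c → a - c) (≡.sym (centre-negate e)))

  χ-reflect : ∀ {a b} → modulus ∣ a + b → χ a ≡ - χ b
  χ-reflect {a} {b} a+b≡0 = χ-negated-by negate value-negate (matches-negate a+b≡0)
    (matches-negate (≡.subst (modulus ∣_) (ℤ.+-comm a b) a+b≡0))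

  χ-periodic : ∀ a t → χ (a + t * modulus) ≡ χ a
  χ-periodic a t = begin
    χ (a + t * modulus)   ≡⟨ χ-reflect (divides t (identity₁ a t modulus)) ⟩
    - χ (- a)             ≡⟨ ≡.cong -_ (χ-reflect (divides (+ 0) (identity₂ a modulus))) ⟩
    - - χ a               ≡⟨ ℤ.neg-involutive (χ a) ⟩
    χ a                       ∎
    where
    open ≡.≡-Reasoning
    identity₁ : ∀ a t m → a + t * m + - a ≡ t * m
    identity₁ = solve-∀
    identity₂ : ∀ a m → - a + a ≡ + 0 * m
    identity₂ = solve-∀

  χ-shift-6p : ∀ a → χ (a + + 6 * pℤ) ≡ - χ a
  χ-shift-6p a = χ-negated-by flip₁ value-flip₁ forward backward
    where
    centre-flip₁ : ∀ e → modulus ∣ centre e + + 6 * pℤ - centre (flip₁ e)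
    centre-flip₁ (Sign.+ , s₂ , s₃) = divides (+ 1) (identity (σ s₂) (σ s₃) pℤ ℓℤ)
      where
      identity : ∀ b c p l →
        + 6 * p + + 1 * (+ 3 * p) + b * (+ 2 * p) + c * (+ 6 * l) + + 6 * p
          - (+ 6 * p + - + 1 * (+ 3 * p) + b * (+ 2 * p) + c * (+ 6 * l)) ≡ + 1 * (+ 12 * p)
      identity = solve-∀
    centre-flip₁ (Sign.- , s₂ , s₃) = divides (+ 0) (identity (σ s₂) (σ s₃) pℤ ℓℤ)
      where
      identity : ∀ b c p l →
        + 6 * p + - + 1 * (+ 3 * p) + b * (+ 2 * p) + c * (+ 6 * l) + + 6 * p
          - (+ 6 * p + + 1 * (+ 3 * p) + b * (+ 2 * p) + c * (+ 6 * l)) ≡ + 0 * (+ 12 * p)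
      identity = solve-∀

    forward : ∀ {e} → Matches a e → Matches (a + + 6 * pℤ) (flip₁ e)
    forward {e} m = matches-shift (divides (+ 0) (identity a pℤ)) m (centre-flip₁ e)
      where
      identity : ∀ a p → a + + 6 * p - (a + + 6 * p) ≡ + 0 * (+ 12 * p)
      identity = solve-∀

    backward : ∀ {e} → Matches (a + + 6 * pℤ) e → Matches a (flip₁ e)
    backward {e} m = matches-shift (divides (- + 1) (identity a pℤ)) m (centre-flip₁ e)
      where
      identity : ∀ a p → a - (a + + 6 * p + + 6 * p) ≡ - + 1 * (+ 12 * p)
      identity = solve-∀

  χ-shift-4p : ∀ a → + 3 ∣ a + + 2 * pℤ → χ (a + + 4 * pℤ) ≡ - χ a
  χ-shift-4p a 3∣a+2p = χ-negated-by flip₂ value-flip₂ forward backward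
    where
    shifted : ∀ s₁ s₃ → a + + 4 * pℤ - centre (s₁ , Sign.+ , s₃) ≡ a - centre (s₁ , Sign.- , s₃)
    shifted s₁ s₃ = identity a (σ s₁) (σ s₃) pℤ ℓℤ
      where
      identity : ∀ n a c p l → n + + 4 * p - (+ 6 * p + a * (+ 3 * p) + + 1 * (+ 2 * p) + c * (+ 6 * l))
        ≡ n - (+ 6 * p + a * (+ 3 * p) + - + 1 * (+ 2 * p) + c * (+ 6 * l))
      identity = solve-∀

    -- Since 3 ∣ a + 2p, the residue of a (resp. a + 4p) modulo 3 forces ε₂ = -1 (resp. ε₂ = +1).
    a-residue : + 3 ∣ a - σ Sign.- * (+ 2 * pℤ)
    a-residue = ≡.subst (+ 3 ∣_) (identity a pℤ) 3∣a+2p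
      where
      identity : ∀ a p → a + + 2 * p ≡ a - - + 1 * (+ 2 * p)
      identity = solve-∀

    a+4p-residue : + 3 ∣ a + + 4 * pℤ - σ Sign.+ * (+ 2 * pℤ)
    a+4p-residue = ≡.subst (+ 3 ∣_) (identity a pℤ) 3∣a+2p
      where
      identity : ∀ a p → a + + 2 * p ≡ a + + 4 * p - + 1 * (+ 2 * p)
      identity = solve-∀

    forward : ∀ {e} → Matches a e → Matches (a + + 4 * pℤ) (flip₂ e)
    forward {s₁ , s₂ , s₃} m with sign-unique a _ s₂ Sign.- 3∤4p (residue₂ m) a-residue
    ... | ≡.refl = matches (≡.subst (modulus ∣_) (≡.sym (shifted s₁ s₃)) (divisible m))

    backward : ∀ {e} → Matches (a + + 4 * pℤ) e → Matches a (flip₂ e)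
    backward {s₁ , s₂ , s₃} m with sign-unique (a + + 4 * pℤ) _ s₂ Sign.+ 3∤4p (residue₂ m) a+4p-residue
    ... | ≡.refl = matches (≡.subst (modulus ∣_) (shifted s₁ s₃) (divisible m))

  χ₊ : ℕ → ℤ
  χ₊ n = χ (+ n)

  private
    pos-multiple : ∀ t → + (t ℕ.* (12 ℕ.* p)) ≡ + t * modulus
    pos-multiple t = ≡.trans (ℤ.pos-* t (12 ℕ.* p)) (≡.cong (+ t *_) (ℤ.pos-* 12 p))

  χ₊-even : ∀ {n} → 2 ℕ.∣ n → χ₊ n ≡ + 0
  χ₊-even 2∣n = χ-even (∣ᵤ⇒∣ 2∣n)

  χ₊-three : ∀ {n} → 3 ℕ.∣ n → χ₊ n ≡ + 0
  χ₊-three 3∣n = χ-three (∣ᵤ⇒∣ 3∣n)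

  χ₊-periodic : ∀ x t → χ₊ (x ℕ.+ t ℕ.* (12 ℕ.* p)) ≡ χ₊ x
  χ₊-periodic x t = ≡.trans (≡.cong (λ y → χ (+ x + y)) (pos-multiple t)) (χ-periodic (+ x) (+ t))

  χ₊-reflect : ∀ {x y} t → x ℕ.+ y ≡ t ℕ.* (12 ℕ.* p) → χ₊ x ≡ - χ₊ y
  χ₊-reflect t x+y≡t*12p = χ-reflect (divides (+ t) (≡.trans (≡.cong +_ x+y≡t*12p) (pos-multiple t)))

  χ₊-shift-6p : ∀ x → χ₊ (x ℕ.+ 6 ℕ.* p) ≡ - χ₊ x
  χ₊-shift-6p x = ≡.trans (≡.cong (λ y → χ (+ x + y)) (ℤ.pos-* 6 p)) (χ-shift-6p (+ x))

  χ₊-shift-4p : ∀ x → 3 ℕ.∣ x ℕ.+ 2 ℕ.* p → χ₊ (x ℕ.+ 4 ℕ.* p) ≡ - χ₊ x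
  χ₊-shift-4p x 3∣x+2p = ≡.trans (≡.cong (λ y → χ (+ x + y)) (ℤ.pos-* 4 p))
    (χ-shift-4p (+ x) (≡.subst (+ 3 ∣_) (≡.cong (λ y → + x + y) (ℤ.pos-* 2 p)) (∣ᵤ⇒∣ 3∣x+2p)))

module Term {c ℓ′ : Level} (R : CommutativeRing c ℓ′) (domain : CharZeroDomain R)
            (p ℓ M N : ℕ) (6⊥p : Coprime 6 p) (0<ℓ : 0 ℕ.< ℓ) (ℓ<p : ℓ ℕ.< p) (0<N : 0 ℕ.< N) (M⊥N : Coprime M N)
            (ζ : CommutativeRing.Carrier R) (ζ-primitive : PrimitiveRoot R (24 ℕ.* p ℕ.* N) ζ) where
  open CommutativeRing R renaming (_+_ to _+ᴿ_; _*_ to _*ᴿ_)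
  open import Data.Nat using (_+_; _*_; _<_)
  open RingLemmas R
  open Shifts R using (three-shifts-cancel)
  open Chi p ℓ 6⊥p 0<ℓ ℓ<p using (χ₊; χ₊-even; χ₊-three; χ₊-periodic; χ₊-reflect; χ₊-shift-6p; χ₊-shift-4p; p≢0; 2∤p)
  open CharZeroDomain domain using (noZeroDiv)
  open PrimitiveRoot ζ-primitive using (root; isPrim)
  open import Algebra.Properties.Ring ring using (-‿distribˡ-*; -‿distribʳ-*; -0#≈0#)
  open import Algebra.Properties.Group +-group using (inverseˡ-unique; ⁻¹-involutive)
  import Relation.Binary.Reasoning.Setoid setoid as ≈-Reasoning
  open import Data.Nat.Tactic.RingSolver using (solve)

  instance
    N≢0 : ℕ.NonZero N
    N≢0 = ℕ.>-nonZero 0<N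

  Z : ℕ → Carrier
  Z n = pow R ζ (M * n ℕ.^ 2)

  term : ℕ → Carrier
  term n = intR R (χ₊ n) *ᴿ Z n

  ζ^[24pN]≈1 : ζ ^ (24 * p * N) ≈ 1#
  ζ^[24pN]≈1 = trans (reflexive (≡.sym (pow≡^ ζ (24 * p * N)))) root

  ζ-cong-mod : ∀ {m n} s t → m + 24 * p * N * s ≡ n + 24 * p * N * t → ζ ^ m ≈ ζ ^ n
  ζ-cong-mod = ^-cong-mod {ζ} {24 * p * N} ζ^[24pN]≈1

  ζ^d≉1 : ∀ d → 0 < d → d < 24 * p * N → ¬ ζ ^ d ≈ 1#
  ζ^d≉1 d 0<d d<K ζ^d≈1 = isPrim d 0<d d<K (trans (reflexive (pow≡^ ζ d)) ζ^d≈1)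

  ζ^[12pN]≈-1 : ζ ^ (12 * p * N) ≈ - 1#
  ζ^[12pN]≈-1 = square≈1⇒≈-1 noZeroDiv (ζ ^ H) ζ^2H≈1 (ζ^d≉1 H 0<H (≡.subst (H <_) (≡.sym K≡H+H) (ℕ.m<m+n H 0<H)))
    where
    H : ℕ
    H = 12 * p * N
    0<H : 0 < H
    0<H = ℕ.>-nonZero⁻¹ H {{ℕ.m*n≢0 (12 * p) N {{ℕ.m*n≢0 12 p}}}}
    K≡H+H : 24 * p * N ≡ 12 * p * N + 12 * p * N
    K≡H+H = solve (p ∷ N ∷ [])
    ζ^2H≈1 : ζ ^ H *ᴿ ζ ^ H ≈ 1#
    ζ^2H≈1 = trans (sym (^-homo-* ζ H H)) (trans (reflexive (≡.cong (ζ ^_) (≡.sym K≡H+H))) ζ^[24pN]≈1)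

  ω : ℕ → Carrier
  ω e = ζ ^ (8 * p * N * e)

  1+ω+ω²≈0 : ∀ e → 0 < e → e < 3 → 1# +ᴿ ω e +ᴿ ω e *ᴿ ω e ≈ 0#
  1+ω+ω²≈0 e 0<e e<3 = cube≈1⇒1+x+x²≈0 noZeroDiv (ω e) ω³≈1 (ζ^d≉1 (T * e) 0<Te Te<K)
    where
    T : ℕ
    T = 8 * p * N
    instance
      T≢0 : ℕ.NonZero T
      T≢0 = ℕ.m*n≢0 (8 * p) N {{ℕ.m*n≢0 8 p}}
    3T≡K : 8 * p * N * 3 ≡ 24 * p * N
    3T≡K = solve (p ∷ N ∷ [])
    0<Te : 0 < T * e
    0<Te = ℕ.>-nonZero⁻¹ (T * e) {{ℕ.m*n≢0 T e {{T≢0}} {{ℕ.>-nonZero 0<e}}}}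
    Te<K : T * e < 24 * p * N
    Te<K = ≡.subst (T * e <_) 3T≡K (ℕ.*-monoʳ-< T e<3)
    exponent : 8 * p * N * e + (8 * p * N * e + 8 * p * N * e) + 24 * p * N * 0 ≡ 0 + 24 * p * N * e
    exponent = solve (p ∷ N ∷ e ∷ [])
    ω³≈1 : ω e *ᴿ (ω e *ᴿ ω e) ≈ 1#
    ω³≈1 = begin
      ω e *ᴿ (ω e *ᴿ ω e)               ≈⟨ *-congˡ (^-homo-* ζ (T * e) (T * e)) ⟨
      ω e *ᴿ ζ ^ (T * e + T * e)         ≈⟨ ^-homo-* ζ (T * e) (T * e + T * e) ⟨
      ζ ^ (T * e + (T * e + T * e))      ≈⟨ ζ-cong-mod 0 e exponent ⟩
      ζ ^ 0                              ∎
      where open ≈-Reasoning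

  Z≡ζ^ : ∀ n → Z n ≡ ζ ^ (M * (n * n))
  Z≡ζ^ n = ≡.trans (pow≡^ ζ (M * n ℕ.^ 2)) (≡.cong (λ k → ζ ^ (M * (n * k))) (ℕ.*-identityʳ n))

  Z-cong : ∀ a b s t → M * (a * a) + 24 * p * N * s ≡ M * (b * b) + 24 * p * N * t → Z a ≈ Z b
  Z-cong a b s t eq = begin
    Z a                 ≡⟨ Z≡ζ^ a ⟩
    ζ ^ (M * (a * a))   ≈⟨ ζ-cong-mod s t eq ⟩
    ζ ^ (M * (b * b))   ≡⟨ Z≡ζ^ b ⟨
    Z b                 ∎
    where open ≈-Reasoning

  Z-shift : ∀ a b r s t → M * (a * a) + 24 * p * N * s ≡ M * (b * b) + r + 24 * p * N * t → Z a ≈ Z b *ᴿ ζ ^ r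
  Z-shift a b r s t eq = begin
    Z a                          ≡⟨ Z≡ζ^ a ⟩
    ζ ^ (M * (a * a))            ≈⟨ ζ-cong-mod s t eq ⟩
    ζ ^ (M * (b * b) + r)        ≈⟨ ^-homo-* ζ (M * (b * b)) r ⟩
    ζ ^ (M * (b * b)) *ᴿ ζ ^ r   ≡⟨ ≡.cong (_*ᴿ ζ ^ r) (Z≡ζ^ b) ⟨
    Z b *ᴿ ζ ^ r                 ∎
    where open ≈-Reasoning

  term-zero : ∀ {n} → χ₊ n ≡ + 0 → term n ≈ 0#
  term-zero {n} χ≡0 = trans (*-congʳ (reflexive (≡.cong (intR R) χ≡0))) (zeroˡ (Z n))

  term-cong : ∀ {a b} → χ₊ b ≡ χ₊ a → Z b ≈ Z a → term b ≈ term a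
  term-cong χb≡χa Zb≈Za = *-cong (reflexive (≡.cong (intR R) χb≡χa)) Zb≈Za

  term-scale : ∀ {a b y} → χ₊ b ≡ χ₊ a → Z b ≈ Z a *ᴿ y → term b ≈ term a *ᴿ y
  term-scale {a} {b} {y} χb≡χa Zb≈Za*y = trans (*-cong (reflexive (≡.cong (intR R) χb≡χa)) Zb≈Za*y)
                                               (sym (*-assoc (intR R (χ₊ a)) (Z a) y))

  term-negate : ∀ {a b} → χ₊ b ≡ ℤ.- χ₊ a → Z b ≈ Z a → term b ≈ - term a
  term-negate {a} χb≡-χa Zb≈Za = trans (*-cong (trans (reflexive (≡.cong (intR R) χb≡-χa)) (intR-neg (χ₊ a))) Zb≈Za)
                                       (sym (-‿distribˡ-* (intR R (χ₊ a)) (Z a)))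

  term-negateᶻ : ∀ {a b} → χ₊ b ≡ χ₊ a → Z b ≈ - Z a → term b ≈ - term a
  term-negateᶻ {a} χb≡χa Zb≈-Za = trans (*-cong (reflexive (≡.cong (intR R) χb≡χa)) Zb≈-Za)
                                        (sym (-‿distribʳ-* (intR R (χ₊ a)) (Z a)))

  term-periodic : ∀ x → term (x + 12 * p * N) ≈ term x
  term-periodic x = term-cong (≡.trans (≡.cong χ₊ index) (χ₊-periodic x N))
                              (Z-cong (x + 12 * p * N) x 0 (M * (x + 6 * p * N)) exponent)
    where
    index : x + 12 * p * N ≡ x + N * (12 * p)
    index = solve (x ∷ p ∷ N ∷ [])
    exponent : M * ((x + 12 * p * N) * (x + 12 * p * N)) + 24 * p * N * 0
             ≡ M * (x * x) + 24 * p * N * (M * (x + 6 * p * N))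
    exponent = solve (x ∷ p ∷ N ∷ M ∷ [])

  term-reflect : ∀ {a b} → a + b ≡ 12 * p * N → term b ≈ - term a
  term-reflect {a} {b} a+b≡H = term-negate (χ₊-reflect N b+a≡N*12p) (Z-cong b a (M * a) (M * (6 * p * N)) exponent)
    where
    open ≡.≡-Reasoning
    b+a≡N*12p : b + a ≡ N * (12 * p)
    b+a≡N*12p = ≡.trans (ℕ.+-comm b a) (≡.trans a+b≡H (solve (p ∷ N ∷ [])))
    square-swap : ∀ {h} → a + b ≡ h → M * (b * b) + 2 * h * (M * a) ≡ M * (a * a) + h * (M * h)
    square-swap ≡.refl = solve (a ∷ b ∷ M ∷ [])
    K≡2H : 24 * p * N ≡ 2 * (12 * p * N)
    K≡2H = solve (p ∷ N ∷ [])
    HMH≡KM6pN : 12 * p * N * (M * (12 * p * N)) ≡ 24 * p * N * (M * (6 * p * N))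
    HMH≡KM6pN = solve (p ∷ N ∷ M ∷ [])
    exponent : M * (b * b) + 24 * p * N * (M * a) ≡ M * (a * a) + 24 * p * N * (M * (6 * p * N))
    exponent = begin
      M * (b * b) + 24 * p * N * (M * a)               ≡⟨ ≡.cong (λ k → M * (b * b) + k * (M * a)) K≡2H ⟩
      M * (b * b) + 2 * (12 * p * N) * (M * a)         ≡⟨ square-swap a+b≡H ⟩
      M * (a * a) + 12 * p * N * (M * (12 * p * N))   ≡⟨ ≡.cong (λ k → M * (a * a) + k) HMH≡KM6pN ⟩
      M * (a * a) + 24 * p * N * (M * (6 * p * N))     ∎

  private
    Z*ζ^[12pN]≈-Z : ∀ x → Z x *ᴿ ζ ^ (12 * p * N) ≈ - Z x
    Z*ζ^[12pN]≈-Z x = trans (*-congˡ ζ^[12pN]≈-1) (trans (sym (-‿distribʳ-* (Z x) 1#)) (-‿cong (*-identityʳ (Z x))))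

  -- For odd x, M (x + 6pN)² = M x² + 12pN · M (x + 3pN) and ζ^(12pN) = -1.  If N is even, then M and
  -- x + 3pN are odd, so Z changes sign and χ does not; if N is odd, it is the other way round.
  term-antiperiodic-even-N : ∀ {x} q b → x ≡ 1 + q * 2 → N ≡ b * 2 → term (x + 6 * p * N) ≈ - term x
  term-antiperiodic-even-N {x} q b x≡1+2q N≡2b with M divMod 2
  ... | result j zero M≡2j with M⊥N (ℕ.divides j M≡2j , ℕ.divides b N≡2b)
  ...   | ()
  term-antiperiodic-even-N {x} q b x≡1+2q N≡2b | result j (suc zero) M≡1+2j =
    term-negateᶻ (≡.trans (≡.cong χ₊ (index N≡2b)) (χ₊-periodic x b))
                 (trans (Z-shift (x + 6 * p * N) x (12 * p * N) 0 _ (exponent x≡1+2q N≡2b M≡1+2j)) (Z*ζ^[12pN]≈-Z x))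
    where
    index : ∀ {N} → N ≡ b * 2 → x + 6 * p * N ≡ x + b * (12 * p)
    index ≡.refl = solve (x ∷ p ∷ b ∷ [])
    exponent : ∀ {x N M} → x ≡ 1 + q * 2 → N ≡ b * 2 → M ≡ 1 + j * 2 →
      M * ((x + 6 * p * N) * (x + 6 * p * N)) + 24 * p * N * 0
        ≡ M * (x * x) + 12 * p * N + 24 * p * N * (q + 3 * p * b + j * (1 + q * 2 + 6 * p * b))
    exponent ≡.refl ≡.refl ≡.refl = solve (p ∷ q ∷ b ∷ j ∷ [])

  term-antiperiodic-odd-N : ∀ {x} q b → x ≡ 1 + q * 2 → N ≡ 1 + b * 2 → term (x + 6 * p * N) ≈ - term x
  term-antiperiodic-odd-N {x} q b x≡1+2q N≡1+2b with p divMod 2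
  ... | result r zero p≡2r = ⊥-elim (2∤p (ℕ.divides r p≡2r))
  ... | result r (suc zero) p≡1+2r =
    term-negate (≡.trans (≡.cong χ₊ (index N≡1+2b)) (≡.trans (χ₊-periodic (x + 6 * p) b) (χ₊-shift-6p x)))
                (Z-cong (x + 6 * p * N) x 0 _ (exponent x≡1+2q N≡1+2b p≡1+2r))
    where
    index : ∀ {N} → N ≡ 1 + b * 2 → x + 6 * p * N ≡ x + 6 * p + b * (12 * p)
    index ≡.refl = solve (x ∷ p ∷ b ∷ [])
    exponent : ∀ {x N p} → x ≡ 1 + q * 2 → N ≡ 1 + b * 2 → p ≡ 1 + r * 2 →
      M * ((x + 6 * p * N) * (x + 6 * p * N)) + 24 * p * N * 0
        ≡ M * (x * x) + 24 * p * N * (M * (2 + q + 3 * r + 3 * b + 6 * r * b))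
    exponent ≡.refl ≡.refl ≡.refl = solve (M ∷ q ∷ b ∷ r ∷ [])

  term-antiperiodic : ∀ x → term (x + 6 * p * N) ≈ - term x
  term-antiperiodic x with x divMod 2 | N divMod 2
  ... | result q zero x≡2q | _ =
    trans (term-zero (χ₊-even (ℕ.divides (q + 3 * p * N) (even x≡2q))))
          (trans (sym -0#≈0#) (-‿cong (sym (term-zero (χ₊-even (ℕ.divides q x≡2q))))))
    where
    even : ∀ {x} → x ≡ q * 2 → x + 6 * p * N ≡ (q + 3 * p * N) * 2
    even ≡.refl = solve (q ∷ p ∷ N ∷ [])
  ... | result q (suc zero) x≡1+2q | result b zero N≡2b         = term-antiperiodic-even-N q b x≡1+2q N≡2b
  ... | result q (suc zero) x≡1+2q | result b (suc zero) N≡1+2b = term-antiperiodic-odd-N q b x≡1+2q N≡1+2b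

  term-periodic₃ : ∀ x → term (x + 3 * (4 * p * N)) ≈ term x
  term-periodic₃ x = trans (reflexive (≡.cong term index)) (term-periodic x)
    where
    index : x + 3 * (4 * p * N) ≡ x + 12 * p * N
    index = solve (x ∷ p ∷ N ∷ [])

  term-at-multiple-of-3 : ∀ u → term (3 * u) ≈ 0#
  term-at-multiple-of-3 u = term-zero (χ₊-three (ℕ.divides u (ℕ.*-comm 3 u)))

  term-pair : ∀ u → χ₊ (3 * u + 2 * (4 * p * N)) ≡ ℤ.- χ₊ (3 * u + 4 * p * N) →
    term (3 * u + 4 * p * N) +ᴿ term (3 * u + 2 * (4 * p * N)) ≈ 0#
  term-pair u χ-flips = trans (+-congˡ (term-negate χ-flips Z-equal)) (-‿inverseʳ _)
    where
    exponent : M * ((3 * u + 2 * (4 * p * N)) * (3 * u + 2 * (4 * p * N))) + 24 * p * N * 0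
             ≡ M * ((3 * u + 4 * p * N) * (3 * u + 4 * p * N)) + 24 * p * N * (M * (u + 2 * p * N))
    exponent = solve (M ∷ u ∷ p ∷ N ∷ [])
    Z-equal : Z (3 * u + 2 * (4 * p * N)) ≈ Z (3 * u + 4 * p * N)
    Z-equal = Z-cong (3 * u + 2 * (4 * p * N)) (3 * u + 4 * p * N) 0 (M * (u + 2 * p * N)) exponent

  -- Here 4pN ≡ 4p (mod 12p).
  χ-pair-flips₁ : ∀ c → N ≡ 1 + c * 3 → ∀ u → χ₊ (3 * u + 2 * (4 * p * N)) ≡ ℤ.- χ₊ (3 * u + 4 * p * N)
  χ-pair-flips₁ c N≡1+3c u = ≡.trans (≡.cong χ₊ (index N≡1+3c))
    (≡.trans (χ₊-periodic (3 * u + 4 * p * N + 4 * p) c)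
             (χ₊-shift-4p (3 * u + 4 * p * N) (ℕ.divides (u + 2 * p + 4 * p * c) (residue N≡1+3c))))
    where
    index : ∀ {N} → N ≡ 1 + c * 3 → 3 * u + 2 * (4 * p * N) ≡ 3 * u + 4 * p * N + 4 * p + c * (12 * p)
    index ≡.refl = solve (u ∷ p ∷ c ∷ [])
    residue : ∀ {N} → N ≡ 1 + c * 3 → 3 * u + 4 * p * N + 2 * p ≡ (u + 2 * p + 4 * p * c) * 3
    residue ≡.refl = solve (u ∷ p ∷ c ∷ [])

  -- Here 4pN ≡ -4p (mod 12p).
  χ-pair-flips₂ : ∀ c → N ≡ 2 + c * 3 → ∀ u → χ₊ (3 * u + 2 * (4 * p * N)) ≡ ℤ.- χ₊ (3 * u + 4 * p * N)
  χ-pair-flips₂ c N≡2+3c u = begin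
    χ₊ w₂                             ≡⟨ ℤ.neg-involutive (χ₊ w₂) ⟨
    ℤ.- ℤ.- χ₊ w₂                     ≡⟨ ≡.cong ℤ.-_ (χ₊-shift-4p w₂ (ℕ.divides (u + 6 * p + 8 * p * c) (residue N≡2+3c))) ⟨
    ℤ.- χ₊ (w₂ + 4 * p)               ≡⟨ ≡.cong (λ k → ℤ.- χ₊ k) (index N≡2+3c) ⟩
    ℤ.- χ₊ (w₁ + suc c * (12 * p))    ≡⟨ ≡.cong ℤ.-_ (χ₊-periodic w₁ (suc c)) ⟩
    ℤ.- χ₊ w₁                         ∎
    where
    open ≡.≡-Reasoning
    w₁ w₂ : ℕ
    w₁ = 3 * u + 4 * p * N
    w₂ = 3 * u + 2 * (4 * p * N)
    index : ∀ {N} → N ≡ 2 + c * 3 → 3 * u + 2 * (4 * p * N) + 4 * p ≡ 3 * u + 4 * p * N + suc c * (12 * p)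
    index ≡.refl = solve (u ∷ p ∷ c ∷ [])
    residue : ∀ {N} → N ≡ 2 + c * 3 → 3 * u + 2 * (4 * p * N) + 2 * p ≡ (u + 6 * p + 8 * p * c) * 3
    residue ≡.refl = solve (u ∷ p ∷ c ∷ [])

  3∤4pN : ¬ 3 ℕ.∣ N → ¬ 3 ℕ.∣ 4 * p * N
  3∤4pN 3∤N 3∣4pN = 3∤N (ℕ.∣m+n∣m⇒∣n (coprime-divisor 3⊥p (≡.subst (3 ℕ.∣_) rearrange 3∣4pN)) (ℕ.m∣m*n N))
    where
    3⊥p : Coprime 3 p
    3⊥p (d∣3 , d∣p) = 6⊥p (ℕ.∣-trans d∣3 (ℕ.divides 2 ≡.refl) , d∣p)
    rearrange : 4 * p * N ≡ p * (3 * N + N)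
    rearrange = solve (p ∷ N ∷ [])

  term-three-shifts-3∣N : ∀ c → N ≡ c * 3 → ∀ n →
    term n +ᴿ term (n + 4 * p * N) +ᴿ term (n + 2 * (4 * p * N)) ≈ 0#
  term-three-shifts-3∣N c N≡3c n = by-residue ((M * n) divMod 3)
    where
    χ-d : χ₊ (n + 4 * p * N) ≡ χ₊ n
    χ-d = ≡.trans (≡.cong χ₊ (index N≡3c)) (χ₊-periodic n c)
      where
      index : ∀ {N} → N ≡ c * 3 → n + 4 * p * N ≡ n + c * (12 * p)
      index ≡.refl = solve (n ∷ p ∷ c ∷ [])

    χ-2d : χ₊ (n + 2 * (4 * p * N)) ≡ χ₊ n
    χ-2d = ≡.trans (≡.cong χ₊ (index N≡3c)) (χ₊-periodic n (2 * c))
      where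
      index : ∀ {N} → N ≡ c * 3 → n + 2 * (4 * p * N) ≡ n + 2 * c * (12 * p)
      index ≡.refl = solve (n ∷ p ∷ c ∷ [])

    3⊥M : Coprime 3 M
    3⊥M (d∣3 , d∣M) = M⊥N (d∣M , ℕ.∣-trans d∣3 (ℕ.divides c N≡3c))

    y : Carrier
    y = ζ ^ (8 * p * N * (M * n))

    shift-d : term (n + 4 * p * N) ≈ term n *ᴿ y
    shift-d = term-scale χ-d (Z-shift (n + 4 * p * N) n _ 0 (2 * p * c * M) (exponent N≡3c))
      where
      exponent : ∀ {N} → N ≡ c * 3 →
        M * ((n + 4 * p * N) * (n + 4 * p * N)) + 24 * p * N * 0
          ≡ M * (n * n) + 8 * p * N * (M * n) + 24 * p * N * (2 * p * c * M)
      exponent ≡.refl = solve (M ∷ n ∷ p ∷ c ∷ [])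

    shift-2d : term (n + 2 * (4 * p * N)) ≈ term n *ᴿ (y *ᴿ y)
    shift-2d = term-scale χ-2d (trans (Z-shift (n + 2 * (4 * p * N)) n _ 0 (8 * p * c * M) (exponent N≡3c))
                                      (*-congˡ (^-homo-* ζ (8 * p * N * (M * n)) (8 * p * N * (M * n)))))
      where
      exponent : ∀ {N} → N ≡ c * 3 →
        M * ((n + 2 * (4 * p * N)) * (n + 2 * (4 * p * N))) + 24 * p * N * 0
          ≡ M * (n * n) + (8 * p * N * (M * n) + 8 * p * N * (M * n)) + 24 * p * N * (8 * p * c * M)
      exponent ≡.refl = solve (M ∷ n ∷ p ∷ c ∷ [])

    -- ζ^(8pN) is a primitive cube root of unity and 3 ∤ M n here.
    roots-cancel : ∀ e → 0 < e → e < 3 → ∀ w → M * n ≡ e + w * 3 →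
      term n +ᴿ term (n + 4 * p * N) +ᴿ term (n + 2 * (4 * p * N)) ≈ 0#
    roots-cancel e 0<e e<3 w Mn≡e+3w = begin
      term n +ᴿ term (n + 4 * p * N) +ᴿ term (n + 2 * (4 * p * N))  ≈⟨ +-cong (+-congˡ shift-d) shift-2d ⟩
      term n +ᴿ term n *ᴿ y +ᴿ term n *ᴿ (y *ᴿ y)                    ≈⟨ a[1+x+x²]≈a+ax+ax² (term n) y ⟨
      term n *ᴿ (1# +ᴿ y +ᴿ y *ᴿ y)                                  ≈⟨ *-congˡ 1+y+y²≈0 ⟩
      term n *ᴿ 0#                                                   ≈⟨ zeroʳ (term n) ⟩
      0#                                                             ∎
      where
      open ≈-Reasoning
      exponent : 8 * p * N * (e + w * 3) + 24 * p * N * 0 ≡ 8 * p * N * e + 24 * p * N * w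
      exponent = solve (p ∷ N ∷ e ∷ w ∷ [])
      y≈ω : y ≈ ω e
      y≈ω = ζ-cong-mod 0 w (≡.trans (≡.cong (λ k → 8 * p * N * k + 24 * p * N * 0) Mn≡e+3w) exponent)
      1+y+y²≈0 : 1# +ᴿ y +ᴿ y *ᴿ y ≈ 0#
      1+y+y²≈0 = trans (+-cong (+-congˡ y≈ω) (*-cong y≈ω y≈ω)) (1+ω+ω²≈0 e 0<e e<3)

    by-residue : DivMod (M * n) 3 → term n +ᴿ term (n + 4 * p * N) +ᴿ term (n + 2 * (4 * p * N)) ≈ 0#
    by-residue (result w zero Mn≡3w) =
      trans (+-cong (+-cong (term-zero χn≡0) (term-zero (≡.trans χ-d χn≡0))) (term-zero (≡.trans χ-2d χn≡0)))
            (trans (+-identityʳ (0# +ᴿ 0#)) (+-identityʳ 0#))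
      where
      χn≡0 : χ₊ n ≡ + 0
      χn≡0 = χ₊-three (coprime-divisor 3⊥M (ℕ.divides w Mn≡3w))
    by-residue (result w (suc zero) Mn≡1+3w)       = roots-cancel 1 ℕ.z<s (ℕ.s<s ℕ.z<s) w Mn≡1+3w
    by-residue (result w (suc (suc zero)) Mn≡2+3w) = roots-cancel 2 ℕ.z<s (ℕ.s<s (ℕ.s<s ℕ.z<s)) w Mn≡2+3w

  term-three-shifts : ∀ n → term n +ᴿ term (n + 4 * p * N) +ᴿ term (n + 2 * (4 * p * N)) ≈ 0#
  term-three-shifts n with N divMod 3
  ... | result c zero N≡3c = term-three-shifts-3∣N c N≡3c n
  ... | result c (suc zero) N≡1+3c =
    three-shifts-cancel term (4 * p * N) (3∤4pN (3∤remainder {q = c} N≡1+3c ℕ.z<s (ℕ.s<s ℕ.z<s)))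
      term-periodic₃ term-at-multiple-of-3 (λ u → term-pair u (χ-pair-flips₁ c N≡1+3c u)) n
  ... | result c (suc (suc zero)) N≡2+3c =
    three-shifts-cancel term (4 * p * N) (3∤4pN (3∤remainder {q = c} N≡2+3c ℕ.z<s (ℕ.s<s (ℕ.s<s ℕ.z<s))))
      term-periodic₃ term-at-multiple-of-3 (λ u → term-pair u (χ-pair-flips₂ c N≡2+3c u)) n

  term-at-0 : term 0 ≈ 0#
  term-at-0 = term-zero (χ₊-even (ℕ.divides 0 ≡.refl))

  term-at-L : term (2 * p * N) ≈ 0#
  term-at-L = term-zero (χ₊-even (ℕ.divides (p * N) L≡pN*2))
    where
    L≡pN*2 : 2 * p * N ≡ p * N * 2
    L≡pN*2 = solve (p ∷ N ∷ [])

  term-middle : ∀ n → term (n + 2 * p * N) ≈ term n +ᴿ term (n + 2 * (2 * p * N))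
  term-middle n = begin
    term (n + L)                     ≈⟨ ⁻¹-involutive (term (n + L)) ⟨
    - - term (n + L)                 ≈⟨ -‿cong (term-antiperiodic (n + L)) ⟨
    - term (n + L + 6 * p * N)       ≡⟨ ≡.cong (λ k → - term k) index₄ ⟩
    - term (n + 2 * (4 * p * N))     ≈⟨ inverseˡ-unique _ _ (term-three-shifts n) ⟨
    term n +ᴿ term (n + 4 * p * N)   ≡⟨ ≡.cong (λ k → term n +ᴿ term k) index₂ ⟩
    term n +ᴿ term (n + 2 * L)       ∎
    where
    open ≈-Reasoning
    L : ℕ
    L = 2 * p * N
    index₄ : n + 2 * p * N + 6 * p * N ≡ n + 2 * (4 * p * N)
    index₄ = solve (n ∷ p ∷ N ∷ [])
    index₂ : n + 4 * p * N ≡ n + 2 * (2 * p * N)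
    index₂ = solve (n ∷ p ∷ N ∷ [])

  term-mirror : ∀ a b → a + b ≡ 3 * (2 * p * N) → term a ≈ term b
  term-mirror a b a+b≡3L = begin
    term a                   ≈⟨ ⁻¹-involutive (term a) ⟨
    - - term a               ≈⟨ -‿cong (term-antiperiodic a) ⟨
    - term (a + 6 * p * N)   ≈⟨ term-reflect (sum a+b≡3L) ⟨
    term b                   ∎
    where
    open ≈-Reasoning
    regroup : a + 6 * p * N + b ≡ a + b + 6 * p * N
    regroup = solve (a ∷ b ∷ p ∷ N ∷ [])
    3L+6pN≡H : 3 * (2 * p * N) + 6 * p * N ≡ 12 * p * N
    3L+6pN≡H = solve (p ∷ N ∷ [])
    sum : a + b ≡ 3 * (2 * p * N) → a + 6 * p * N + b ≡ 12 * p * N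
    sum a+b≡3L = ≡.trans regroup (≡.trans (≡.cong (_+ 6 * p * N) a+b≡3L) 3L+6pN≡H)

open import Data.Nat using (_*_; _<_; _^_)

corollary3p6 : {c ℓ : Level} (R : CommutativeRing c ℓ) → CharZeroDomain R →
    (p₃ ℓ₃ M N : ℕ) → 0 < p₃ → Coprime 6 p₃ → 0 < ℓ₃ → ℓ₃ < p₃ →
    0 < M → 0 < N → Coprime M N →
    (ζ : CommutativeRing.Carrier R) → PrimitiveRoot R (24 * p₃ * N) ζ →
    let open CommutativeRing R using (_≈_) renaming (_*_ to _*ᴿ_)
        term = λ (n : ℕ) → intR R (chi 2 3 p₃ 1 1 ℓ₃ (+ n)) *ᴿ pow R ζ (M * n ^ 2)
    in sumTo R term (6 * p₃ * N) ≈ intR R (+ 4) *ᴿ sumTo R term (2 * p₃ * N)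
corollary3p6 R domain p₃ ℓ₃ M N _ 6⊥p₃ 0<ℓ₃ ℓ₃<p₃ _ 0<N M⊥N ζ ζ-primitive = begin
  sumTo R term (6 * p₃ * N)          ≡⟨ ≡.cong (sumTo R term) 6pN≡3L ⟩
  sumTo R term (3 * L)               ≈⟨ sumTo[3L]≈4×sumTo[L] term L term-at-0 term-at-L term-middle term-mirror ⟩
  4 × sumTo R term L                 ≈⟨ natR*≈× 4 (sumTo R term L) ⟨
  intR R (+ 4) *ᴿ sumTo R term L     ∎
  where
  open CommutativeRing R using (setoid; +-monoid) renaming (_*_ to _*ᴿ_)
  open Sums R
  open Term R domain p₃ ℓ₃ M N 6⊥p₃ 0<ℓ₃ ℓ₃<p₃ 0<N M⊥N ζ ζ-primitive
  open import Relation.Binary.Reasoning.Setoid setoid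
  open import Algebra.Properties.Monoid.Mult +-monoid using (_×_)
  open import Data.Nat.Tactic.RingSolver using (solve)

  L : ℕ
  L = 2 * p₃ * N

  6pN≡3L : 6 * p₃ * N ≡ 3 * (2 * p₃ * N)
  6pN≡3L = solve (p₃ ∷ N ∷ [])
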